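{- Suppose $\mathbf{B}\subseteq\mathbf{K}$ is left-leaning. Then $\mathbf{B}$ is closed. In particular, if $\mathbf{A}$ is an enumerated structure and $f\in\mathrm{OL}(\mathbf{A},\mathbf{K})$, then $f[\mathbf{A}]$ is closed.
   Context: Setting: finite relational language $\mathcal{L}=\{U_i:i<k^{\mathsf{u}}\}\cup\{R_i:i<k\}$ with conventions: each vertex satisfies exactly one $U_i$ ($U(a)=i$); $R_i(a,a)$ never; distinct $a,b$ satisfy exactly one $R_i(a,b)$ ($R(a,b)=i$); an involution $\mathrm{Flip}$ of $k$ fixing $0$ with $R_i(a,b)\iff R_{\mathrm{Flip}(i)}(b,a)$; $R=0$ means no relation. $\mathcal{F}$ a finite set of finite irreducible structures (irreducible: $R(a,b)\ne0$ for distinct $a,b$), $\mathcal{K}=\mathrm{Forb}(\mathcal{F})$. Standing assumption: every $i<k^{\mathsf{u}}$ is non-degenerate (some two-element structure in $\mathcal{K}$ has a vertex of unary $i$ and a nonzero relation). $\mathbf{K}$ is a fixed enumerated left-dense Fra\"iss\'e limit of $\mathcal{K}$ (underlying set $\omega$; $\mathbf{K}_n$ induced on $\{0,\dots,n-1\}$; left dense: for every enumerated $\mathbf{B}\in\mathcal{K}$ with $|\mathbf{B}|=m+1$, $\mathbf{B}_m=\mathbf{K}_m$, there is an order-preserving embedding fixing $\{0,\dots,m-1\}$ with $R(f(m),r)=0$ for $m\le r<f(m)$). Enumerated structures have a cardinal as underlying set. $T=k^{\mathsf{u}}\times k^{<\omega}$, $t=(t^{\mathsf{u}},t^{\mathsf{b}})$,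 $\ell(t)=|t^{\mathsf{b}}|$, $T(n)$ the nodes of length $n$; $s\sqsubseteq t$ iff $s^{\mathsf{u}}=t^{\mathsf{u}}$ and $t^{\mathsf{b}}$ extends $s^{\mathsf{b}}$; $s\perp t$ iff incomparable; for $s^{\mathsf{u}}=t^{\mathsf{u}}$, $s\wedge t$ is their longest common initial segment; $t|_m$ is the restriction to length $m$; $\preceq_{lex}$ on $T(n)$ compares unaries then lexicographically. Coding map $c(n)\in T(n)$, $c(n)^{\mathsf{u}}=U(n)$, $c(n)^{\mathsf{b}}(m)=R(n,m)$. For $S=\{s_0\prec_{lex}\dots\prec_{lex}s_{d-1}\}\subseteq T(n)$ and an $\mathcal{L}_d$-structure $\mathbf{B}$ (binary symbols plus unaries $V_0,\dots,V_{d-1}$ partitioning vertices), $\mathbf{B}[S]$ is the $\mathcal{L}$-structure on $\{0,\dots,n-1\}\cup B$ equal to $\mathbf{K}_n$ there, with binary part of $\mathbf{B}$ on $B$, $U(b)=s_{V(b)}^{\mathsf{u}}$, $R(b,x)=s_{V(b)}^{\mathsf{b}}(x)$; $\mathcal{K}(S)=\{\mathbf{B}:\mathbf{B}[S]\in\mathcal{K}\}$. For $\mathbf{A}\subseteq\mathbf{K}$: $c[\mathbf{A}]|_m=\{c(a)|_m: a\in\mathbf{A}, a\ge m\}$; $\mathrm{sp}(\mathbf{A})=\{\ell(c(a)\wedge c(b)): a,b\in\mathbf{A}, U(a)=U(b), c(a)\perp c(b)\}$; $\mathrm{AC}(\mathbf{A})=\{m\notin\mathbf{A}\cup\mathrm{sp}(\mathbf{A}):\mathcal{K}(c[\mathbf{A}]|_m)\neq\mathcal{K}(c[\mathbf{A}]|_{m+1})\}$;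 $\mathbf{A}$ is closed if $\mathrm{sp}(\mathbf{A})\subseteq\mathbf{A}$ and $\mathrm{AC}(\mathbf{A})=\emptyset$. $\mathbf{B}\subseteq\mathbf{K}$ is left-leaning if whenever $a\in\mathbf{B}$, $x<a$, $R(a,x)\neq0$, then $x\in\mathbf{B}$. $\mathrm{OL}(\mathbf{A},\mathbf{K})$ denotes the order-preserving embeddings with left-leaning image. -}

module Defs where

open import Data.Nat using (ℕ; zero; suc; _<_; _≤_)
open import Data.Fin as F using (Fin; toℕ; inject₁; fromℕ)
open import Data.Fin.Properties using () renaming (_≟_ to _≟F_)
open import Data.List using (List; []; _∷_; map; take; upTo; _++_; length)
open import Data.List.Membership.Propositional using (_∈_)
open import Data.Maybe using (Maybe; just; nothing)
open import Data.Product using (Σ; ∃; _×_; _,_; proj₁; proj₂)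
open import Data.Sum using (_⊎_; inj₁; inj₂)
open import Data.Empty using (⊥)
open import Relation.Nullary using (¬_; yes; no)
open import Relation.Binary.PropositionalEquality using (_≡_; _≢_)
open import Function.Definitions using (Injective; Surjective)
open import Function.Bundles using (_⇔_)

-- The finite relational language L = {U_i : i < ku} ∪ {R_i : i < k}.
-- We take k = suc k₀ so that the "no relation" symbol 0 exists.

record Lang : Set where
  field
    ku      : ℕ
    k₀      : ℕ
    Flip    : Fin (suc k₀) → Fin (suc k₀)
    Flip-inv : ∀ i → Flip (Flip i) ≡ i
    Flip-0  : Flip F.zero ≡ F.zero

module Setup (L : Lang) where
  open Lang L public

  Rel : Set
  Rel = Fin (suc k₀)

  record Str (X : Set) : Set where
    field
      U : X → Fin ku
      R : X → X → Rel
  open Str public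

  IsStr : {X : Set} → Str X → Set
  IsStr {X} A = (∀ (a : X) → R A a a ≡ F.zero) × (∀ (a b : X) → R A b a ≡ Flip (R A a b))

  Irreducible : {X : Set} → Str X → Set
  Irreducible {X} A = ∀ (a b : X) → a ≢ b → R A a b ≢ F.zero

  IsEmb : {X Y : Set} → Str X → Str Y → (X → Y) → Set
  IsEmb {X} A B f = Injective _≡_ _≡_ f × (∀ a → U B (f a) ≡ U A a)
                    × (∀ (a b : X) → R B (f a) (f b) ≡ R A a b)

  FinStr : Set
  FinStr = Σ ℕ (λ p → Str (Fin p))

  InForb : List FinStr → {X : Set} → Str X → Set
  InForb Fs A = ∀ {G} → G ∈ Fs → ¬ ∃ (λ f → IsEmb (proj₂ G) A f)

  record Setting : Set₁ where
    field
      Fs       : List FinStr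
      Fs-ok    : ∀ {G} → G ∈ Fs → IsStr (proj₂ G) × Irreducible (proj₂ G)
      nondeg   : ∀ (i : Fin ku) → ∃ λ (A : Str (Fin 2)) → IsStr A × InForb Fs A
                   × (∃ λ x → U A x ≡ i) × R A F.zero (F.suc F.zero) ≢ F.zero
      K        : Str ℕ
      K-str    : IsStr K
      K-age    : ∀ p (A : Str (Fin p)) → IsStr A → (InForb Fs A ⇔ ∃ (λ f → IsEmb A K f))
      K-homog  : ∀ p (g h : Fin p → ℕ) → Injective _≡_ _≡_ g → Injective _≡_ _≡_ h
                   → (∀ i → U K (g i) ≡ U K (h i)) → (∀ i j → R K (g i) (g j) ≡ R K (h i) (h j))
                   → ∃ λ (σ : ℕ → ℕ) → IsEmb K K σ × Surjective _≡_ _≡_ σ × (∀ i → σ (g i) ≡ h i)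
      K-left   : ∀ m (B : Str (Fin (suc m))) → IsStr B → InForb Fs B
                   → (∀ (i : Fin m) → U B (inject₁ i) ≡ U K (toℕ i))
                   → (∀ (i j : Fin m) → R B (inject₁ i) (inject₁ j) ≡ R K (toℕ i) (toℕ j))
                   → ∃ λ (f : Fin (suc m) → ℕ) → IsEmb B K f
                       × (∀ (i j : Fin (suc m)) → i F.< j → f i < f j)
                       × (∀ (i : Fin m) → f (inject₁ i) ≡ toℕ i)
                       × (∀ r → m ≤ r → r < f (fromℕ m) → R K (f (fromℕ m)) r ≡ F.zero)

  Node : Set
  Node = Fin ku × List Rel

  ℓ : Node → ℕ
  ℓ t = length (proj₂ t)

  _⊑_ : Node → Node → Set
  s ⊑ t = proj₁ s ≡ proj₁ t × ∃ λ xs → proj₂ t ≡ proj₂ s ++ xs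

  _⊥T_ : Node → Node → Set
  s ⊥T t = ¬ (s ⊑ t) × ¬ (t ⊑ s)

  meetLen : List Rel → List Rel → ℕ
  meetLen (x ∷ xs) (y ∷ ys) with x ≟F y
  ... | yes _ = suc (meetLen xs ys)
  ... | no _  = zero
  meetLen _ _ = zero

  restrict : ℕ → Node → Node
  restrict m t = proj₁ t , take m (proj₂ t)

  lexL : List Rel → List Rel → Set
  lexL (x ∷ xs) (y ∷ ys) = x F.< y ⊎ (x ≡ y × lexL xs ys)
  lexL _ _ = ⊥

  _≺lex_ : Node → Node → Set
  s ≺lex t = proj₁ s F.< proj₁ t ⊎ (proj₁ s ≡ proj₁ t × lexL (proj₂ s) (proj₂ t))

  NodeSet : Set₁
  NodeSet = Node → Set

  LexEnum : NodeSet → ℕ → (ℕ → Node) → Set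
  LexEnum S d e = (∀ i → i < d → S (e i)) × (∀ t → S t → ∃ λ i → i < d × e i ≡ t)
                  × (∀ i j → i < j → j < d → e i ≺lex e j)

  -- L_d-structures: binary part plus unary V; V b < d is imposed in 𝒦(S)
  record LdStr : Set where
    field
      size : ℕ
      V    : Fin size → ℕ
      RB   : Fin size → Fin size → Rel
  open LdStr public

  IsLdStr : LdStr → Set
  IsLdStr B = (∀ a → RB B a a ≡ F.zero) × (∀ a b → RB B b a ≡ Flip (RB B a b))

  lookupD : List Rel → ℕ → Rel
  lookupD [] _ = F.zero
  lookupD (x ∷ xs) zero = x
  lookupD (x ∷ xs) (suc i) = lookupD xs i

  module WithK (St : Setting) where
    open Setting St public

    c : ℕ → Node
    c n = U K n , map (R K n) (upTo n)

    BS : (n : ℕ) → (e : ℕ → Node) → (B : LdStr) → Str (Fin n ⊎ Fin (size B))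
    U (BS n e B) (inj₁ x) = U K (toℕ x)
    U (BS n e B) (inj₂ b) = proj₁ (e (V B b))
    R (BS n e B) (inj₁ x) (inj₁ y) = R K (toℕ x) (toℕ y)
    R (BS n e B) (inj₂ b) (inj₁ x) = lookupD (proj₂ (e (V B b))) (toℕ x)
    R (BS n e B) (inj₁ x) (inj₂ b) = Flip (lookupD (proj₂ (e (V B b))) (toℕ x))
    R (BS n e B) (inj₂ a) (inj₂ b) = RB B a b

    KS : ℕ → NodeSet → LdStr → Set
    KS n S B = IsLdStr B × ∃ λ d → ∃ λ e → LexEnum S d e × (∀ b → V B b < d)
               × InForb Fs (BS n e B)

    cRes : (ℕ → Set) → ℕ → NodeSet
    cRes A m t = ∃ λ a → A a × m ≤ a × restrict m (c a) ≡ t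

    sp : (ℕ → Set) → ℕ → Set
    sp A m = ∃ λ a → ∃ λ b → A a × A b × U K a ≡ U K b × (c a ⊥T c b)
             × meetLen (proj₂ (c a)) (proj₂ (c b)) ≡ m

    AC : (ℕ → Set) → ℕ → Set
    AC A m = ¬ A m × ¬ sp A m
             × ¬ (∀ B → KS m (cRes A m) B ⇔ KS (suc m) (cRes A (suc m)) B)

    Closed : (ℕ → Set) → Set
    Closed A = (∀ m → sp A m → A m) × (∀ m → ¬ AC A m)

    LeftLeaning : (ℕ → Set) → Set
    LeftLeaning B = ∀ a x → B a → x < a → R K a x ≢ F.zero → B x

    -- enumerated structures: underlying set a cardinal (finite p, or ω = nothing)
    Card : Set
    Card = Maybe ℕ

    El : Card → Set
    El (just p) = Fin p
    El nothing  = ℕ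

    elℕ : {κ : Card} → El κ → ℕ
    elℕ {just p} x = toℕ x
    elℕ {nothing} x = x

    image : {κ : Card} → (El κ → ℕ) → ℕ → Set
    image f x = ∃ λ a → f a ≡ x

    OL : {κ : Card} → Str (El κ) → (El κ → ℕ) → Set
    OL {κ} A f = IsEmb A K f × (∀ (a b : El κ) → elℕ a < elℕ b → f a < f b)
                 × LeftLeaning (image f)

-- sp(B) ⊆ B: if c a and c b split at level i, then R(a,i) ≠ R(b,i), so one of them is a nonzero
-- relation to i < a, b, and left-leaning puts i into B.
-- AC(B) = ∅: if m ∉ B, every a ∈ B with a ≥ m satisfies a > m and R(a,m) = 0, so
-- c[B]|_{m+1} is c[B]|_m with 0 appended to every node. Then B[c[B]|_{m+1}] is B[c[B]|_m]
-- together with the vertex m, which is unrelated to the new vertices. An irreducible forbidden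
-- structure embedded there either avoids m, and so lies in B[c[B]|_m], or contains m, and so
-- lies in K_{m+1}; hence 𝒦(c[B]|_m) = 𝒦(c[B]|_{m+1}).
module Submission where

open import Defs
open import Data.Nat using (ℕ; zero; suc; _<_; _≤_; s≤s; z≤n)
open import Data.Nat.Properties using (<⇒≤; <-trans; ≤∧≢⇒<; m≤n⇒m⊓n≡m; suc-injective)
open import Data.Product using (_×_; ∃; _,_; proj₁; proj₂)
open import Data.Sum using (_⊎_; inj₁; inj₂; map₁)
open import Data.Sum.Properties using (inj₁-injective)
open import Data.Empty using (⊥-elim)
open import Data.List using (List; []; _∷_; _∷ʳ_; _++_; take; length; applyUpTo; upTo)
open import Data.List.Properties using (length-map; length-upTo; length-take; map-applyUpTo)
open import Data.List.Membership.Propositional using (_∈_)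
open import Data.Fin as F using (Fin; toℕ; inject₁; fromℕ; lower₁)
open import Data.Fin.Properties
  using (toℕ-injective; toℕ-fromℕ; toℕ-inject₁; inject₁-injective; inject₁-lower₁; toℕ<n; any?)
  renaming (_≟_ to _≟F_; <-irrefl to <F-irrefl)
open import Function using (_∘_; id)
open import Function.Bundles using (_⇔_; mk⇔; Equivalence)
open import Function.Properties.Equivalence using () renaming (sym to ⇔-sym; trans to ⇔-trans)
open import Relation.Nullary using (¬_; Dec; yes; no)
open import Relation.Nullary.Decidable using (map′)
open import Relation.Binary.PropositionalEquality
  using (_≡_; _≢_; refl; sym; trans; cong; cong₂; subst; subst₂; module ≡-Reasoning)

module _ (L : Lang) where
  open Setup L

  lookupD-++ˡ : ∀ (xs ys : List Rel) {i} → i < length xs → lookupD (xs ++ ys) i ≡ lookupD xs i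
  lookupD-++ˡ (x ∷ xs) ys {zero}  _         = refl
  lookupD-++ˡ (x ∷ xs) ys {suc i} (s≤s i<n) = lookupD-++ˡ xs ys i<n

  lookupD-∷ʳ-length : ∀ (xs : List Rel) z → lookupD (xs ∷ʳ z) (length xs) ≡ z
  lookupD-∷ʳ-length []       z = refl
  lookupD-∷ʳ-length (x ∷ xs) z = lookupD-∷ʳ-length xs z

  lookupD-applyUpTo : ∀ (f : ℕ → Rel) n {i} → i < n → lookupD (applyUpTo f n) i ≡ f i
  lookupD-applyUpTo f (suc n) {zero}  _         = refl
  lookupD-applyUpTo f (suc n) {suc i} (s≤s i<n) = lookupD-applyUpTo (f ∘ suc) n i<n

  take-suc-lookupD : ∀ (xs : List Rel) {i} → i < length xs → take (suc i) xs ≡ take i xs ∷ʳ lookupD xs i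
  take-suc-lookupD (x ∷ xs) {zero}  _         = refl
  take-suc-lookupD (x ∷ xs) {suc i} (s≤s i<n) = cong (x ∷_) (take-suc-lookupD xs i<n)

  take-length-++ : ∀ {A : Set} (xs ys : List A) → take (length xs) (xs ++ ys) ≡ xs
  take-length-++ []       ys = refl
  take-length-++ (x ∷ xs) ys = cong (x ∷_) (take-length-++ xs ys)

  length-take-≤ : ∀ {A : Set} m (xs : List A) → m ≤ length xs → length (take m xs) ≡ m
  length-take-≤ m xs m≤n = trans (length-take m xs) (m≤n⇒m⊓n≡m m≤n)

  meetLen-incomparable : ∀ (xs ys : List Rel) →
    ¬ (∃ λ zs → ys ≡ xs ++ zs) → ¬ (∃ λ zs → xs ≡ ys ++ zs) →
    let i = meetLen xs ys in
    i < length xs × i < length ys × lookupD xs i ≢ lookupD ys i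
  meetLen-incomparable []       ys       xs⋢ys ys⋢xs = ⊥-elim (xs⋢ys (ys , refl))
  meetLen-incomparable (x ∷ xs) []       xs⋢ys ys⋢xs = ⊥-elim (ys⋢xs (x ∷ xs , refl))
  meetLen-incomparable (x ∷ xs) (y ∷ ys) xs⋢ys ys⋢xs with x ≟F y
  ... | no x≢y   = s≤s z≤n , s≤s z≤n , x≢y
  ... | yes refl =
    let (i<m , i<n , differ) = meetLen-incomparable xs ys
                                 (λ (zs , eq) → xs⋢ys (zs , cong (x ∷_) eq))
                                 (λ (zs , eq) → ys⋢xs (zs , cong (x ∷_) eq))
    in s≤s i<m , s≤s i<n , differ

  lexL-∷ʳ : ∀ xs ys z → lexL xs ys → lexL (xs ∷ʳ z) (ys ∷ʳ z)
  lexL-∷ʳ (x ∷ xs) (y ∷ ys) z (inj₁ x<y)        = inj₁ x<y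
  lexL-∷ʳ (x ∷ xs) (y ∷ ys) z (inj₂ (x≡y , lt)) = inj₂ (x≡y , lexL-∷ʳ xs ys z lt)

  lexL-∷ʳ⁻ : ∀ xs ys z → length xs ≡ length ys → lexL (xs ∷ʳ z) (ys ∷ʳ z) → lexL xs ys
  lexL-∷ʳ⁻ []       []       z _  (inj₁ z<z)       = ⊥-elim (<F-irrefl refl z<z)
  lexL-∷ʳ⁻ (x ∷ xs) (y ∷ ys) z _  (inj₁ x<y)       = inj₁ x<y
  lexL-∷ʳ⁻ (x ∷ xs) (y ∷ ys) z eq (inj₂ (x≡y , lt)) =
    inj₂ (x≡y , lexL-∷ʳ⁻ xs ys z (suc-injective eq) lt)

  appendZero : Node → Node
  appendZero (u , xs) = u , xs ∷ʳ F.zero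

  AppendZero : NodeSet → NodeSet
  AppendZero S t = ∃ λ s → S s × appendZero s ≡ t

  ≺lex-appendZero : ∀ s t → s ≺lex t → appendZero s ≺lex appendZero t
  ≺lex-appendZero s t (inj₁ u<u′)        = inj₁ u<u′
  ≺lex-appendZero s t (inj₂ (u≡u′ , lt)) = inj₂ (u≡u′ , lexL-∷ʳ (proj₂ s) (proj₂ t) F.zero lt)

  ≺lex-appendZero⁻ : ∀ s t → ℓ s ≡ ℓ t → appendZero s ≺lex appendZero t → s ≺lex t
  ≺lex-appendZero⁻ s t eq (inj₁ u<u′)        = inj₁ u<u′
  ≺lex-appendZero⁻ s t eq (inj₂ (u≡u′ , lt)) = inj₂ (u≡u′ , lexL-∷ʳ⁻ (proj₂ s) (proj₂ t) F.zero eq lt)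

  restrict-appendZero : ∀ {n} s → ℓ s ≡ n → restrict n (appendZero s) ≡ s
  restrict-appendZero (u , xs) refl = cong (u ,_) (take-length-++ xs (F.zero ∷ []))

  IsEmb-∘ : {X Y Z : Set} {A : Str X} {B : Str Y} {C : Str Z} {g : Y → Z} {f : X → Y} →
            IsEmb B C g → IsEmb A B f → IsEmb A C (g ∘ f)
  IsEmb-∘ (g-inj , gU , gR) (f-inj , fU , fR) =
    (λ eq → f-inj (g-inj eq)) , (λ a → trans (gU _) (fU a)) , (λ a b → trans (gR _ _) (fR a b))

  IsEmb-factor : {X Y Z : Set} {A : Str X} {B : Str Y} {C : Str Z} {g : Y → Z} {h : X → Z} {h′ : X → Y} →
                 IsEmb B C g → IsEmb A C h → (∀ a → g (h′ a) ≡ h a) → IsEmb A B h′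
  IsEmb-factor {C = C} {g = g} {h′ = h′} (g-inj , gU , gR) (h-inj , hU , hR) gh′≡h =
    (λ {a} {b} eq → h-inj (trans (sym (gh′≡h a)) (trans (cong g eq) (gh′≡h b))))
    , (λ a → trans (sym (gU (h′ a))) (trans (cong (U C) (gh′≡h a)) (hU a)))
    , (λ a b → trans (sym (gR (h′ a) (h′ b))) (trans (cong₂ (R C) (gh′≡h a) (gh′≡h b)) (hR a b)))

  InForb-sub : {Fs : List FinStr} {X Y : Set} {A : Str X} {B : Str Y} {g : X → Y} →
               IsEmb A B g → InForb Fs B → InForb Fs A
  InForb-sub {B = B} g-emb forb G∈ (h , h-emb) = forb G∈ (_ , IsEmb-∘ {C = B} g-emb h-emb)

  Irreducible-image-adjacent : ∀ {p} {X : Set} {G : Str (Fin p)} {S : Str X} {h : Fin p → X} →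
    Irreducible G → IsEmb G S h → ∀ v w → h w ≡ h v ⊎ R S (h v) (h w) ≢ F.zero
  Irreducible-image-adjacent irr (_ , _ , hR) v w with w ≟F v
  ... | yes refl = inj₁ refl
  ... | no w≢v   = inj₂ (λ r → irr v w (w≢v ∘ sym) (trans (sym (hR v w)) r))

  Induced₁ : {X Y : Set} → Str (X ⊎ Y) → Str X
  Induced₁ S = record { U = U S ∘ inj₁ ; R = λ x y → R S (inj₁ x) (inj₁ y) }

  inj₁-IsEmb : {X Y : Set} (S : Str (X ⊎ Y)) → IsEmb (Induced₁ S) S inj₁
  inj₁-IsEmb S = inj₁-injective , (λ _ → refl) , (λ _ _ → refl)

  top : ∀ {m} {Y : Set} → Fin (suc m) ⊎ Y
  top {m} = inj₁ (fromℕ m)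

  top? : ∀ {m} {Y : Set} (z : Fin (suc m) ⊎ Y) → Dec (z ≡ top)
  top? (inj₁ x) = map′ (cong inj₁) inj₁-injective (x ≟F fromℕ _)
  top? (inj₂ y) = no λ ()

  lowerTop : ∀ {m} {Y : Set} (z : Fin (suc m) ⊎ Y) → z ≢ top → Fin m ⊎ Y
  lowerTop {m} (inj₁ x) x≢top =
    inj₁ (lower₁ x λ m≡x → x≢top (cong inj₁ (toℕ-injective (trans (sym m≡x) (sym (toℕ-fromℕ m))))))
  lowerTop (inj₂ y) _ = inj₂ y

  inject₁-lowerTop : ∀ {m} {Y : Set} (z : Fin (suc m) ⊎ Y) (z≢top : z ≢ top) →
                     map₁ inject₁ (lowerTop z z≢top) ≡ z
  inject₁-lowerTop (inj₁ x) _ = cong inj₁ (inject₁-lower₁ x _)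
  inject₁-lowerTop (inj₂ y) _ = refl

  below-top : ∀ {m} {Y : Set} (S : Str (Fin (suc m) ⊎ Y)) → (∀ y → R S top (inj₂ y) ≡ F.zero) →
              ∀ z → z ≡ top ⊎ R S top z ≢ F.zero → ∃ λ x → inj₁ x ≡ z
  below-top S top-isolated (inj₁ x) _               = x , refl
  below-top S top-isolated (inj₂ y) (inj₂ adjacent) = ⊥-elim (adjacent (top-isolated y))

  module _ (St : Setting) where
    open WithK St

    K-omits-Fs : ∀ {G} → G ∈ Fs → ¬ ∃ (IsEmb (proj₂ G) K)
    K-omits-Fs {p , G} G∈ G↪K =
      Equivalence.from (K-age p G (proj₁ (Fs-ok G∈))) G↪K G∈ (id , id , (λ _ → refl) , (λ _ _ → refl))

    InForb-one-point-extension : ∀ {m} {Y : Set} (S₁ : Str (Fin m ⊎ Y)) (S₂ : Str (Fin (suc m) ⊎ Y)) →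
      IsEmb S₁ S₂ (map₁ inject₁) → (∀ y → R S₂ top (inj₂ y) ≡ F.zero) → ∃ (IsEmb (Induced₁ S₂) K) →
      InForb Fs S₁ → InForb Fs S₂
    InForb-one-point-extension S₁ S₂ g-emb top-isolated (κ , κ-emb) forb {p , G} G∈ (h , h-emb)
      with any? (λ v → top? (h v))
    ... | no top∉h =
      forb G∈ (h₁ , IsEmb-factor {A = G} {B = S₁} {C = S₂} g-emb h-emb (λ v → inject₁-lowerTop (h v) (h≢top v)))
      where
        h≢top : ∀ v → h v ≢ top
        h≢top v eq = top∉h (v , eq)
        h₁ : Fin p → Fin _ ⊎ _
        h₁ v = lowerTop (h v) (h≢top v)
    ... | yes (v , hv≡top) =
      K-omits-Fs G∈ (_ , IsEmb-∘ {B = Induced₁ S₂} {C = K} κ-emb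
                           (IsEmb-factor {A = G} {C = S₂} (inj₁-IsEmb S₂) h-emb (proj₂ ∘ h₁)))
      where
        h₁ : ∀ w → ∃ λ x → inj₁ x ≡ h w
        h₁ w = below-top S₂ top-isolated (h w)
                 (subst (λ t → h w ≡ t ⊎ R S₂ t (h w) ≢ F.zero) hv≡top
                   (Irreducible-image-adjacent {S = S₂} (proj₂ (Fs-ok G∈)) h-emb v w))

    module _ {n : ℕ} (B : LdStr) (e e′ : ℕ → Node)
             (e′≡ : ∀ b → e′ (V B b) ≡ appendZero (e (V B b)))
             (ℓe≡ : ∀ b → ℓ (e (V B b)) ≡ n) where

      lookupD-appendZero : ∀ b (x : Fin n) →
        lookupD (proj₂ (e′ (V B b))) (toℕ (inject₁ x)) ≡ lookupD (proj₂ (e (V B b))) (toℕ x)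
      lookupD-appendZero b x = begin
        lookupD (proj₂ (e′ (V B b))) (toℕ (inject₁ x))
          ≡⟨ cong₂ lookupD (cong proj₂ (e′≡ b)) (toℕ-inject₁ x) ⟩
        lookupD (proj₂ (e (V B b)) ∷ʳ F.zero) (toℕ x)
          ≡⟨ lookupD-++ˡ (proj₂ (e (V B b))) _ (subst (toℕ x <_) (sym (ℓe≡ b)) (toℕ<n x)) ⟩
        lookupD (proj₂ (e (V B b))) (toℕ x) ∎
        where open ≡-Reasoning

      BS-appendZero-IsEmb : IsEmb (BS n e B) (BS (suc n) e′ B) (map₁ inject₁)
      BS-appendZero-IsEmb = map₁-inject₁-injective , preservesU , preservesR
        where
          map₁-inject₁-injective : ∀ {y z} → map₁ inject₁ y ≡ map₁ inject₁ z → y ≡ z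
          map₁-inject₁-injective {inj₁ x} {inj₁ x′} eq = cong inj₁ (inject₁-injective (inj₁-injective eq))
          map₁-inject₁-injective {inj₂ b} {inj₂ b′} refl = refl

          preservesU : ∀ y → U (BS (suc n) e′ B) (map₁ inject₁ y) ≡ U (BS n e B) y
          preservesU (inj₁ x) = cong (U K) (toℕ-inject₁ x)
          preservesU (inj₂ b) = cong proj₁ (e′≡ b)

          preservesR : ∀ y z → R (BS (suc n) e′ B) (map₁ inject₁ y) (map₁ inject₁ z) ≡ R (BS n e B) y z
          preservesR (inj₁ x) (inj₁ x′) = cong₂ (R K) (toℕ-inject₁ x) (toℕ-inject₁ x′)
          preservesR (inj₂ b) (inj₁ x)  = lookupD-appendZero b x
          preservesR (inj₁ x) (inj₂ b)  = cong Flip (lookupD-appendZero b x)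
          preservesR (inj₂ a) (inj₂ b)  = refl

      BS-appendZero-top-isolated : ∀ b → R (BS (suc n) e′ B) top (inj₂ b) ≡ F.zero
      BS-appendZero-top-isolated b = begin
        Flip (lookupD (proj₂ (e′ (V B b))) (toℕ (fromℕ n)))
          ≡⟨ cong Flip (cong₂ lookupD (cong proj₂ (e′≡ b)) (trans (toℕ-fromℕ n) (sym (ℓe≡ b)))) ⟩
        Flip (lookupD (proj₂ (e (V B b)) ∷ʳ F.zero) (ℓ (e (V B b))))
          ≡⟨ cong Flip (lookupD-∷ʳ-length (proj₂ (e (V B b))) F.zero) ⟩
        Flip F.zero
          ≡⟨ Flip-0 ⟩
        F.zero ∎
        where open ≡-Reasoning

    BS-Induced₁-IsEmb : ∀ n e B → IsEmb (Induced₁ (BS n e B)) K toℕ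
    BS-Induced₁-IsEmb n e B = toℕ-injective , (λ _ → refl) , (λ _ _ → refl)

    LexEnum-cong : ∀ {S S′ d e} → (∀ t → S t ⇔ S′ t) → LexEnum S d e → LexEnum S′ d e
    LexEnum-cong S⇔S′ (mem , surj , ord) =
      (λ i i<d → Equivalence.to (S⇔S′ _) (mem i i<d))
      , (λ t S′t → surj t (Equivalence.from (S⇔S′ t) S′t))
      , ord

    KS-cong : ∀ {n S S′} → (∀ t → S t ⇔ S′ t) → ∀ B → KS n S B ⇔ KS n S′ B
    KS-cong S⇔S′ B = mk⇔
      (λ (isB , d , e , enum , V<d , forb) → isB , d , e , LexEnum-cong S⇔S′ enum , V<d , forb)
      (λ (isB , d , e , enum , V<d , forb) → isB , d , e , LexEnum-cong (⇔-sym ∘ S⇔S′) enum , V<d , forb)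

    module _ {n : ℕ} {S : NodeSet} (ℓS : ∀ t → S t → ℓ t ≡ n) (B : LdStr) where

      KS→KS-AppendZero : KS n S B → KS (suc n) (AppendZero S) B
      KS→KS-AppendZero (isB , d , e , (mem , surj , ord) , V<d , forb) =
        isB , d , appendZero ∘ e , (mem′ , surj′ , ord′) , V<d ,
        InForb-one-point-extension (BS n e B) (BS (suc n) (appendZero ∘ e) B)
          (BS-appendZero-IsEmb B e (appendZero ∘ e) (λ _ → refl) ℓe≡)
          (BS-appendZero-top-isolated B e (appendZero ∘ e) (λ _ → refl) ℓe≡)
          (toℕ , BS-Induced₁-IsEmb (suc n) (appendZero ∘ e) B) forb
        where
          ℓe≡ : ∀ b → ℓ (e (V B b)) ≡ n
          ℓe≡ b = ℓS _ (mem _ (V<d b))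
          mem′ : ∀ i → i < d → AppendZero S (appendZero (e i))
          mem′ i i<d = e i , mem i i<d , refl
          surj′ : ∀ t → AppendZero S t → ∃ λ i → i < d × appendZero (e i) ≡ t
          surj′ t (s , Ss , s⁺≡t) =
            let (i , i<d , eᵢ≡s) = surj s Ss in i , i<d , trans (cong appendZero eᵢ≡s) s⁺≡t
          ord′ : ∀ i j → i < j → j < d → appendZero (e i) ≺lex appendZero (e j)
          ord′ i j i<j j<d = ≺lex-appendZero (e i) (e j) (ord i j i<j j<d)

      KS-AppendZero→KS : KS (suc n) (AppendZero S) B → KS n S B
      KS-AppendZero→KS (isB , d , e′ , (mem , surj , ord) , V<d , forb) =
        isB , d , e , (mem′ , surj′ , ord′) , V<d ,
        InForb-sub {A = BS n e B} {B = BS (suc n) e′ B} (BS-appendZero-IsEmb B e e′ (λ b → proj₁ (spec (V<d b))) (λ b → proj₁ (proj₂ (spec (V<d b))))) forb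
        where
          e : ℕ → Node
          e i = restrict n (e′ i)
          spec : ∀ {i} → i < d → e′ i ≡ appendZero (e i) × ℓ (e i) ≡ n × S (e i)
          spec {i} i<d =
            let (s , Ss , s⁺≡e′ᵢ) = mem i i<d
                eᵢ≡s = trans (cong (restrict n) (sym s⁺≡e′ᵢ)) (restrict-appendZero s (ℓS s Ss))
            in trans (sym s⁺≡e′ᵢ) (cong appendZero (sym eᵢ≡s)) , trans (cong ℓ eᵢ≡s) (ℓS s Ss)
               , subst S (sym eᵢ≡s) Ss
          mem′ : ∀ i → i < d → S (e i)
          mem′ i i<d = proj₂ (proj₂ (spec i<d))
          surj′ : ∀ t → S t → ∃ λ i → i < d × e i ≡ t
          surj′ t St =
            let (i , i<d , e′ᵢ≡t⁺) = surj (appendZero t) (t , St , refl)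
            in i , i<d , trans (cong (restrict n) e′ᵢ≡t⁺) (restrict-appendZero t (ℓS t St))
          ord′ : ∀ i j → i < j → j < d → e i ≺lex e j
          ord′ i j i<j j<d =
            ≺lex-appendZero⁻ (e i) (e j) (trans (proj₁ (proj₂ (spec i<d))) (sym (proj₁ (proj₂ (spec j<d)))))
              (subst₂ _≺lex_ (proj₁ (spec i<d)) (proj₁ (spec j<d)) (ord i j i<j j<d))
            where i<d = <-trans i<j j<d

      KS-AppendZero : KS n S B ⇔ KS (suc n) (AppendZero S) B
      KS-AppendZero = mk⇔ KS→KS-AppendZero KS-AppendZero→KS

    length-code : ∀ a → length (proj₂ (c a)) ≡ a
    length-code a = trans (length-map (R K a) (upTo a)) (length-upTo a)

    lookupD-code : ∀ a {i} → i < a → lookupD (proj₂ (c a)) i ≡ R K a i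
    lookupD-code a i<a =
      trans (cong (λ xs → lookupD xs _) (map-applyUpTo id (R K a) a)) (lookupD-applyUpTo (R K a) a i<a)

    ℓ-restrict-code : ∀ {m} a → m ≤ a → ℓ (restrict m (c a)) ≡ m
    ℓ-restrict-code {m} a m≤a = length-take-≤ m (proj₂ (c a)) (subst (m ≤_) (sym (length-code a)) m≤a)

    restrict-suc-code : ∀ {m} a → m < a → R K a m ≡ F.zero → restrict (suc m) (c a) ≡ appendZero (restrict m (c a))
    restrict-suc-code {m} a m<a R≡0 = cong (U K a ,_)
      (trans (take-suc-lookupD (proj₂ (c a)) (subst (m <_) (sym (length-code a)) m<a))
             (cong (take m (proj₂ (c a)) ∷ʳ_) (trans (lookupD-code a m<a) R≡0)))

    incomparable-codes-differ : ∀ {a b} → U K a ≡ U K b → c a ⊥T c b →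
      let i = meetLen (proj₂ (c a)) (proj₂ (c b)) in i < a × i < b × R K a i ≢ R K b i
    incomparable-codes-differ {a} {b} Ua≡Ub (a⋢b , b⋢a) =
      i<a , i<b , λ eq → differ (trans (lookupD-code a i<a) (trans eq (sym (lookupD-code b i<b))))
      where
        i = meetLen (proj₂ (c a)) (proj₂ (c b))
        facts = meetLen-incomparable (proj₂ (c a)) (proj₂ (c b))
                  (λ (zs , eq) → a⋢b (Ua≡Ub , zs , eq)) (λ (zs , eq) → b⋢a (sym Ua≡Ub , zs , eq))
        differ : lookupD (proj₂ (c a)) i ≢ lookupD (proj₂ (c b)) i
        differ = proj₂ (proj₂ facts)
        i<a : i < a
        i<a = subst (i <_) (length-code a) (proj₁ facts)
        i<b : i < b
        i<b = subst (i <_) (length-code b) (proj₁ (proj₂ facts))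

    module _ {B : ℕ → Set} (leftLeaning : LeftLeaning B) where

      sp⊆ : ∀ {m} → sp B m → B m
      sp⊆ (a , b , Ba , Bb , Ua≡Ub , a⊥b , refl)
        with incomparable-codes-differ Ua≡Ub a⊥b
      ... | i<a , i<b , differ with R K a _ ≟F F.zero
      ...   | no  Ra≢0 = leftLeaning a _ Ba i<a Ra≢0
      ...   | yes Ra≡0 = leftLeaning b _ Bb i<b (λ Rb≡0 → differ (trans Ra≡0 (sym Rb≡0)))

      gap-above : ∀ {m a} → ¬ B m → B a → m ≤ a → m < a × R K a m ≡ F.zero
      gap-above {m} {a} m∉B Ba m≤a = m<a , R≡0
        where
          m<a = ≤∧≢⇒< m≤a (λ m≡a → m∉B (subst B (sym m≡a) Ba))
          R≡0 : R K a m ≡ F.zero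
          R≡0 with R K a m ≟F F.zero
          ... | yes R≡0 = R≡0
          ... | no  R≢0 = ⊥-elim (m∉B (leftLeaning a m Ba m<a R≢0))

      cRes-suc : ∀ {m} → ¬ B m → ∀ t → AppendZero (cRes B m) t ⇔ cRes B (suc m) t
      cRes-suc {m} m∉B t = mk⇔
        (λ (s , (a , Ba , m≤a , code≡s) , s⁺≡t) →
          let (m<a , R≡0) = gap-above m∉B Ba m≤a
          in a , Ba , m<a , trans (restrict-suc-code a m<a R≡0) (trans (cong appendZero code≡s) s⁺≡t))
        (λ (a , Ba , m<a , code≡t) →
          restrict m (c a) , (a , Ba , <⇒≤ m<a , refl) ,
          trans (sym (restrict-suc-code a m<a (proj₂ (gap-above m∉B Ba (<⇒≤ m<a))))) code≡t)

      ℓ-cRes : ∀ {m} t → cRes B m t → ℓ t ≡ m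
      ℓ-cRes t (a , _ , m≤a , code≡t) = trans (cong ℓ (sym code≡t)) (ℓ-restrict-code a m≤a)

      leftLeaning⇒closed : Closed B
      leftLeaning⇒closed = (λ m → sp⊆) , λ m (m∉B , _ , KS≢) →
        KS≢ λ B′ → ⇔-trans (KS-AppendZero ℓ-cRes B′) (KS-cong (cRes-suc m∉B) B′)

proposition5p5 : (L : Lang) (St : Setup.Setting L) →
    let open Setup L in let open WithK St in
    (∀ (B : ℕ → Set) → LeftLeaning B → Closed B)
    × (∀ (κ : Card) (A : Str (El κ)) → IsStr A → (f : El κ → ℕ) → OL A f → Closed (image f))
proposition5p5 L St =
  (λ B → leftLeaning⇒closed L St)
  , λ κ A _ f (_ , _ , imageLeftLeaning) → leftLeaning⇒closed L St imageLeftLeaning
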